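{- For all positive integers $m,n,k$ with $n\ge m+k$ and every integer $r\ge 0$, \[ \binom{m+k}{m}L_{2r}(n,m+k)=\sum_{l=m}^{n-k}\binom{n}{l}L_{r}(l,m)\,L_{r}(n-l,k). \]
   Context: For a nonnegative integer $r$ and integers $0\le k\le n$, the $r$-Lah number $L_r(n,k)$ is the number of partitions of a set with $n+r$ elements into $k+r$ non-empty linearly ordered subsets such that $r$ distinguished elements lie in distinct subsets; equivalently $L_r(n,k)=\frac{n!}{k!}\binom{n+2r-1}{k+2r-1}$, with exponential generating function $\sum_{n\ge k}L_r(n,k)\frac{t^n}{n!}=\frac{1}{k!}\left(\frac{1}{1-t}-1\right)^k\left(\frac{1}{1-t}\right)^{2r}$. -}

module Defs where

open import Data.Nat using (ℕ; zero; suc; _+_; _*_; _∸_)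
open import Data.Nat.Combinatorics using (_C_; _P_)
open import Data.List using (List; map; upTo)
open import Data.Nat.ListAction using (sum)

-- r-Lah number: L_r(n,k) = n!/k! * C(n+2r-1, k+2r-1) for k ≤ n, and 0 for k > n.
-- n!/k! is written n P (n ∸ k) = n!/k!.
-- The degenerate case n + 2r = 0 (so n = k = r = 0) gives L_0(0,0) = 1.
lah : ℕ → ℕ → ℕ → ℕ
lah r n k with n + 2 * r | k + 2 * r
... | zero  | zero  = 1
... | zero  | suc _ = 0
... | suc a | zero  = 0
... | suc a | suc b = (n P (n ∸ k)) * (a C b)

sumFromTo : ℕ → ℕ → (ℕ → ℕ) → ℕ
sumFromTo lo hi f = sum (map (λ i → f (lo + i)) (upTo (suc hi ∸ lo)))

module Submission where

-- Write m + k + d for n and l = m + i for the summation index.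
-- The r-Lah numbers factor as
--     L_r(m + j, m) = ((m + j)!/m!) · c_{m+2r}(j),
-- where c_s(j) = C(s + j - 1, s - 1) is the coefficient of t^j in (1 - t)^(-s)
-- (lah-split).  Multiplying the two such factorisations in a summand and using
--     C(N, m+i) · (m+i)!/m! · (k+j)!/k! = C(m+k, m) · N!/(m+k)!   (N = m+i+k+j)
-- (summand-factorials) turns every summand into the common factor
-- C(m+k, m) · n!/(m+k)! times c_{m+2r}(i) · c_{k+2r}(d-i).  The remaining sum is
-- the convolution identity (1 - t)^(-p) (1 - t)^(-q) = (1 - t)^(-(p+q)), i.e. a
-- Chu–Vandermonde identity for the c_s (vandermonde), and the right-hand side
-- C(p + q + d - 1, p + q - 1) is exactly the binomial factor of L_{2r}(n, m+k).
--
-- The hypotheses 1 ≤ m and 1 ≤ k of the theorem turn out not to be needed.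

open import Defs
open import Data.Nat using (ℕ; zero; suc; pred; _+_; _*_; _∸_; _/_; _≤_; _≥_; z≤n; s≤s; _!; NonZero)
open import Data.Nat.Properties
open import Data.Nat.Combinatorics using (_C_; _P_; nCn≡1; nCk+nC[k+1]≡[n+1]C[k+1]; nPk≡n!/[n∸k]!; nCk≡n!/k![n-k]!; k![n∸k]!∣n!)
open import Data.Nat.DivMod using (m/n*n≡m)
open import Data.Nat.Divisibility using (_∣_; m≤n⇒m!∣n!)
open import Data.Nat.Tactic.RingSolver using (solve-∀)
open import Data.List using (map; upTo; applyUpTo)
open import Data.Nat.ListAction using (sum)
open import Data.Product using (_,_)
open import Algebra.Properties.CommutativeSemigroup +-commutativeSemigroup using () renaming (interchange to +-interchange; xy∙z≈xz∙y to +-right-comm)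
open import Relation.Binary.PropositionalEquality
open ≡-Reasoning

Σ≤ : ℕ → (ℕ → ℕ) → ℕ
Σ≤ zero    g = g 0
Σ≤ (suc d) g = g 0 + Σ≤ d (λ i → g (suc i))

Σ≤-cong : ∀ d {g h : ℕ → ℕ} → (∀ i → i ≤ d → g i ≡ h i) → Σ≤ d g ≡ Σ≤ d h
Σ≤-cong zero    eq = eq 0 z≤n
Σ≤-cong (suc d) eq = cong₂ _+_ (eq 0 z≤n) (Σ≤-cong d (λ i i≤d → eq (suc i) (s≤s i≤d)))

Σ≤-+ : ∀ d (g h : ℕ → ℕ) → Σ≤ d (λ i → g i + h i) ≡ Σ≤ d g + Σ≤ d h
Σ≤-+ zero    g h = refl
Σ≤-+ (suc d) g h = begin
  (g 0 + h 0) + Σ≤ d (λ i → g (suc i) + h (suc i))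
    ≡⟨ cong ((g 0 + h 0) +_) (Σ≤-+ d (λ i → g (suc i)) (λ i → h (suc i))) ⟩
  (g 0 + h 0) + (Σ≤ d (λ i → g (suc i)) + Σ≤ d (λ i → h (suc i)))
    ≡⟨ +-interchange (g 0) (h 0) _ _ ⟩
  Σ≤ (suc d) g + Σ≤ (suc d) h ∎

Σ≤-*ˡ : ∀ x d (g : ℕ → ℕ) → Σ≤ d (λ i → x * g i) ≡ x * Σ≤ d g
Σ≤-*ˡ x zero    g = refl
Σ≤-*ˡ x (suc d) g =
  trans (cong (x * g 0 +_) (Σ≤-*ˡ x d (λ i → g (suc i)))) (sym (*-distribˡ-+ x (g 0) _))

sum-applyUpTo : ∀ d (g h : ℕ → ℕ) → sum (map g (applyUpTo h (suc d))) ≡ Σ≤ d (λ i → g (h i))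
sum-applyUpTo zero    g h = +-identityʳ (g (h 0))
sum-applyUpTo (suc d) g h = cong (g (h 0) +_) (sum-applyUpTo d g (λ i → h (suc i)))

sumFromTo-Σ≤ : ∀ lo d (f : ℕ → ℕ) → sumFromTo lo (lo + d) f ≡ Σ≤ d (λ i → f (lo + i))
sumFromTo-Σ≤ lo d f = begin
  sum (map (λ i → f (lo + i)) (upTo (suc (lo + d) ∸ lo)))
    ≡⟨ cong (λ t → sum (map (λ i → f (lo + i)) (upTo (t ∸ lo)))) (sym (+-suc lo d)) ⟩
  sum (map (λ i → f (lo + i)) (upTo (lo + suc d ∸ lo)))
    ≡⟨ cong (λ t → sum (map (λ i → f (lo + i)) (upTo t))) (m+n∸m≡n lo (suc d)) ⟩
  sum (map (λ i → f (lo + i)) (upTo (suc d)))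
    ≡⟨ sum-applyUpTo d (λ i → f (lo + i)) (λ i → i) ⟩
  Σ≤ d (λ i → f (lo + i)) ∎

conv : (ℕ → ℕ) → (ℕ → ℕ) → ℕ → ℕ
conv f g d = Σ≤ d (λ i → f i * g (d ∸ i))

δ : ℕ → ℕ
δ zero    = 1
δ (suc _) = 0

shift : (ℕ → ℕ) → ℕ → ℕ
shift h zero    = 0
shift h (suc j) = h j

conv-cong : ∀ f {g h : ℕ → ℕ} d → (∀ j → g j ≡ h j) → conv f g d ≡ conv f h d
conv-cong f d eq = Σ≤-cong d (λ i _ → cong (f i *_) (eq _))

conv-+ : ∀ f g h d → conv f (λ j → g j + h j) d ≡ conv f g d + conv f h d
conv-+ f g h d = begin
  conv f (λ j → g j + h j) d
    ≡⟨ Σ≤-cong d (λ i _ → *-distribˡ-+ (f i) (g (d ∸ i)) (h (d ∸ i))) ⟩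
  Σ≤ d (λ i → f i * g (d ∸ i) + f i * h (d ∸ i))
    ≡⟨ Σ≤-+ d _ _ ⟩
  conv f g d + conv f h d ∎

conv-δ : ∀ f d → conv f δ d ≡ f d
conv-δ f zero    = *-identityʳ (f 0)
conv-δ f (suc d) =
  trans (cong (_+ conv (λ i → f (suc i)) δ d) (*-zeroʳ (f 0))) (conv-δ (λ i → f (suc i)) d)

conv-shift : ∀ f h d → conv f (shift h) (suc d) ≡ conv f h d
conv-shift f h zero    = trans (cong (f 0 * h 0 +_) (*-zeroʳ (f 1))) (+-identityʳ _)
conv-shift f h (suc d) = cong (f 0 * h (suc d) +_) (conv-shift (λ i → f (suc i)) h d)

-- The coefficients c s j of (1 - t)^(-s):  c 0 = δ,  c (s + 1) j = C(s + j, s)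

c : ℕ → ℕ → ℕ
c zero    = δ
c (suc s) j = (s + j) C s

c-zero : ∀ s → c s 0 ≡ 1
c-zero zero    = refl
c-zero (suc s) = trans (cong (_C s) (+-identityʳ s)) (nCn≡1 s)

-- (1 - t)^(-(s+1)) = (1 - t)^(-s) + t (1 - t)^(-(s+1)); for j > 0 this is Pascal's rule.
c-step : ∀ s j → c (suc s) j ≡ c s j + shift (c (suc s)) j
c-step s       zero    = trans (c-zero (suc s)) (sym (cong (_+ 0) (c-zero s)))
c-step zero    (suc j) = refl
c-step (suc s) (suc j) = begin
  suc (s + suc j) C suc s
    ≡⟨ sym (nCk+nC[k+1]≡[n+1]C[k+1] (s + suc j) s) ⟩
  (s + suc j) C s + (s + suc j) C suc s
    ≡⟨ cong (λ t → (s + suc j) C s + t C suc s) (+-suc s j) ⟩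
  (s + suc j) C s + (suc s + j) C suc s ∎

vandermonde : ∀ p q d → conv (c p) (c q) d ≡ c (p + q) d
vandermonde p zero    d       = trans (conv-δ (c p) d) (cong (λ s → c s d) (sym (+-identityʳ p)))
vandermonde p (suc q) zero    = begin
  c p 0 * c (suc q) 0  ≡⟨ cong₂ _*_ (c-zero p) (c-zero (suc q)) ⟩
  1                    ≡⟨ sym (c-zero (p + suc q)) ⟩
  c (p + suc q) 0      ∎
vandermonde p (suc q) (suc d) = begin
  conv (c p) (c (suc q)) (suc d)
    ≡⟨ conv-cong (c p) (suc d) (c-step q) ⟩
  conv (c p) (λ j → c q j + shift (c (suc q)) j) (suc d)
    ≡⟨ conv-+ (c p) (c q) (shift (c (suc q))) (suc d) ⟩
  conv (c p) (c q) (suc d) + conv (c p) (shift (c (suc q))) (suc d)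
    ≡⟨ cong₂ _+_ (vandermonde p q (suc d))
                 (trans (conv-shift (c p) (c (suc q)) d) (vandermonde p (suc q) d)) ⟩
  c (p + q) (suc d) + c (p + suc q) d
    ≡⟨ cong (λ s → c (p + q) (suc d) + c s d) (+-suc p q) ⟩
  c (p + q) (suc d) + shift (c (suc (p + q))) (suc d)
    ≡⟨ sym (c-step (p + q) (suc d)) ⟩
  c (suc (p + q)) (suc d)
    ≡⟨ cong (λ s → c s (suc d)) (sym (+-suc p q)) ⟩
  c (p + suc q) (suc d) ∎

/-*-cancel : ∀ {n d e} .{{_ : NonZero d}} → d ∣ n → d ≡ e → (n / d) * e ≡ n
/-*-cancel d∣n refl = m/n*n≡m d∣n

P-*-! : ∀ a j → ((a + j) P j) * a ! ≡ (a + j) !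
P-*-! a j = begin
  ((a + j) P j) * a !
    ≡⟨ cong (_* a !) (nPk≡n!/[n∸k]! (m≤n+m j a)) ⟩
  ((a + j) ! / ((a + j) ∸ j) !) {{((a + j) ∸ j) !≢0}} * a !
    ≡⟨ /-*-cancel {{((a + j) ∸ j) !≢0}} (m≤n⇒m!∣n! (m∸n≤m (a + j) j)) (cong _! (m+n∸n≡m a j)) ⟩
  (a + j) ! ∎

C-*-! : ∀ a b → ((a + b) C a) * (a ! * b !) ≡ (a + b) !
C-*-! a b = begin
  ((a + b) C a) * (a ! * b !)
    ≡⟨ cong (_* (a ! * b !)) (nCk≡n!/k![n-k]! (m≤m+n a b)) ⟩
  ((a + b) ! / (a ! * ((a + b) ∸ a) !)) {{a !* ((a + b) ∸ a) !≢0}} * (a ! * b !)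
    ≡⟨ /-*-cancel {{a !* ((a + b) ∸ a) !≢0}} (k![n∸k]!∣n! (m≤m+n a b))
                  (cong (λ t → a ! * t !) (m+n∸m≡n a b)) ⟩
  (a + b) ! ∎

*-collect-factorials : ∀ a x y u v → a * x * y * (u * v) ≡ a * (x * u * (y * v))
*-collect-factorials = solve-∀

*-pull-middle : ∀ a x u v → a * x * (u * v) ≡ x * (a * (u * v))
*-pull-middle = solve-∀

*-pair-factors : ∀ a x y u v → a * (x * u) * (y * v) ≡ a * x * y * (u * v)
*-pair-factors = solve-∀

-- Both sides equal N!/(m! k!) for N = (m + i) + (k + j).
summand-factorials : ∀ m k i j →
  (((m + i) + (k + j)) C (m + i)) * ((m + i) P i) * ((k + j) P j)
    ≡ ((m + k) C m) * (((m + i) + (k + j)) P (i + j))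
summand-factorials m k i j = *-cancelʳ-≡ _ _ (m ! * k !) {{m !* k !≢0}} (trans lhs (sym rhs))
  where
  N : ℕ
  N = (m + i) + (k + j)
  regroup : N ≡ (m + k) + (i + j)
  regroup = +-interchange m i k j
  lhs : (N C (m + i)) * ((m + i) P i) * ((k + j) P j) * (m ! * k !) ≡ N !
  lhs = begin
    (N C (m + i)) * ((m + i) P i) * ((k + j) P j) * (m ! * k !)
      ≡⟨ *-collect-factorials (N C (m + i)) ((m + i) P i) ((k + j) P j) (m !) (k !) ⟩
    (N C (m + i)) * (((m + i) P i) * m ! * (((k + j) P j) * k !))
      ≡⟨ cong (λ t → (N C (m + i)) * t) (cong₂ _*_ (P-*-! m i) (P-*-! k j)) ⟩
    (N C (m + i)) * ((m + i) ! * (k + j) !)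
      ≡⟨ C-*-! (m + i) (k + j) ⟩
    N ! ∎
  rhs : ((m + k) C m) * (N P (i + j)) * (m ! * k !) ≡ N !
  rhs = begin
    ((m + k) C m) * (N P (i + j)) * (m ! * k !)
      ≡⟨ *-pull-middle ((m + k) C m) (N P (i + j)) (m !) (k !) ⟩
    (N P (i + j)) * (((m + k) C m) * (m ! * k !))
      ≡⟨ cong ((N P (i + j)) *_) (C-*-! m k) ⟩
    (N P (i + j)) * (m + k) !
      ≡⟨ cong (λ t → (t P (i + j)) * (m + k) !) regroup ⟩
    (((m + k) + (i + j)) P (i + j)) * (m + k) !
      ≡⟨ P-*-! (m + k) (i + j) ⟩
    ((m + k) + (i + j)) !
      ≡⟨ cong _! (sym regroup) ⟩
    N ! ∎

lah-pos : ∀ {r n k a b} → n + 2 * r ≡ suc a → k + 2 * r ≡ suc b →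
  lah r n k ≡ (n P (n ∸ k)) * (a C b)
lah-pos n+2r≡1+a k+2r≡1+b rewrite n+2r≡1+a | k+2r≡1+b = refl

-- L_r(m + j, m) = (m + j)!/m! · C(m + 2r - 1 + j, m + 2r - 1), including the
-- degenerate case m = r = 0 where L_0(j, 0) = [j = 0] = c 0 j.
lah-split : ∀ r m j → lah r (m + j) m ≡ ((m + j) P j) * c (m + 2 * r) j
lah-split r (suc m) j =
  cong₂ (λ x y → ((suc m + j) P x) * (y C (m + 2 * r)))
        (m+n∸m≡n m j) (+-right-comm m j (2 * r))
lah-split (suc r) zero j =
  trans (lah-pos {suc r} {j} {0} {j + b} {b} (+-suc j b) refl)
        (cong (λ x → (j P j) * (x C b)) (+-comm j b))
  where
  b : ℕ
  b = pred (2 * suc r)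
lah-split zero zero zero    = refl
lah-split zero zero (suc j) = sym (*-zeroʳ (suc j P suc j))

summand : ∀ r m k n i j → n ≡ (m + i) + (k + j) →
  (n C (m + i)) * lah r (m + i) m * lah r (n ∸ (m + i)) k
    ≡ ((m + k) C m) * (n P (i + j)) * (c (m + 2 * r) i * c (k + 2 * r) j)
summand r m k n i j refl = begin
  (n C (m + i)) * lah r (m + i) m * lah r (n ∸ (m + i)) k
    ≡⟨ cong (λ x → (n C (m + i)) * lah r (m + i) m * lah r x k) (m+n∸m≡n (m + i) (k + j)) ⟩
  (n C (m + i)) * lah r (m + i) m * lah r (k + j) k
    ≡⟨ cong₂ (λ x y → (n C (m + i)) * x * y) (lah-split r m i) (lah-split r k j) ⟩
  (n C (m + i)) * (((m + i) P i) * cᵢ) * (((k + j) P j) * cⱼ)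
    ≡⟨ *-pair-factors (n C (m + i)) ((m + i) P i) ((k + j) P j) cᵢ cⱼ ⟩
  (n C (m + i)) * ((m + i) P i) * ((k + j) P j) * (cᵢ * cⱼ)
    ≡⟨ cong (_* (cᵢ * cⱼ)) (summand-factorials m k i j) ⟩
  ((m + k) C m) * (n P (i + j)) * (cᵢ * cⱼ) ∎
  where
  cᵢ cⱼ : ℕ
  cᵢ = c (m + 2 * r) i
  cⱼ = c (k + 2 * r) j

-- The exponent of (1 - t) in L_{2r}(n, m + k) is the sum of those of L_r(·, m), L_r(·, k).
exponent-split : ∀ m k r → m + k + 2 * (2 * r) ≡ (m + 2 * r) + (k + 2 * r)
exponent-split = solve-∀

theorem10 : ∀ (m n k r : ℕ) → 1 ≤ m → 1 ≤ k → n ≥ m + k →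
    ((m + k) C m) * lah (2 * r) n (m + k)
      ≡ sumFromTo m (n ∸ k) (λ l → (n C l) * lah r l m * lah r (n ∸ l) k)
theorem10 m n k r _ _ m+k≤n with m≤n⇒∃[o]m+o≡n m+k≤n
... | d , refl = begin
  Cmk * lah (2 * r) n (m + k)
    ≡⟨ cong (Cmk *_) (lah-split (2 * r) (m + k) d) ⟩
  Cmk * ((n P d) * c (m + k + 2 * (2 * r)) d)
    ≡⟨ cong (λ s → Cmk * ((n P d) * c s d)) (exponent-split m k r) ⟩
  Cmk * ((n P d) * c (p + q) d)
    ≡⟨ sym (*-assoc Cmk (n P d) _) ⟩
  K * c (p + q) d
    ≡⟨ cong (K *_) (sym (vandermonde p q d)) ⟩
  K * conv (c p) (c q) d
    ≡⟨ sym (Σ≤-*ˡ K d _) ⟩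
  Σ≤ d (λ i → K * (c p i * c q (d ∸ i)))
    ≡⟨ Σ≤-cong d (λ i i≤d → sym (summand-at i i≤d)) ⟩
  Σ≤ d (λ i → f (m + i))
    ≡⟨ sym (sumFromTo-Σ≤ m d f) ⟩
  sumFromTo m (m + d) f
    ≡⟨ cong (λ hi → sumFromTo m hi f) (sym upper-limit) ⟩
  sumFromTo m (n ∸ k) f ∎
  where
  p q Cmk K : ℕ
  p = m + 2 * r
  q = k + 2 * r
  Cmk = (m + k) C m
  K = Cmk * (n P d)
  f : ℕ → ℕ
  f l = (n C l) * lah r l m * lah r (n ∸ l) k
  upper-limit : n ∸ k ≡ m + d
  upper-limit = trans (cong (_∸ k) (+-right-comm m k d)) (m+n∸n≡m (m + d) k)
  summand-at : ∀ i → i ≤ d → f (m + i) ≡ K * (c p i * c q (d ∸ i))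
  summand-at i i≤d =
    trans (summand r m k n i (d ∸ i) n≡l+[n∸l])
          (cong (λ t → Cmk * (n P t) * (c p i * c q (d ∸ i))) (m+[n∸m]≡n i≤d))
    where
    n≡l+[n∸l] : n ≡ (m + i) + (k + (d ∸ i))
    n≡l+[n∸l] = trans (cong (m + k +_) (sym (m+[n∸m]≡n i≤d))) (+-interchange m k i (d ∸ i))
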